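{- Let $\mathcal H$ be the vector space over a field $k$ with basis the packed words, and define $\Delta:\mathcal H\to\mathcal H\otimes\mathcal H$ on packed words by $$\Delta(w)=\sum_{I+J=[1\dots|w|]}pack(w[I])\otimes pack\big(w[J]/w[I]\big),$$ the sum running over ordered pairs $(I,J)$ of disjoint (possibly empty) subsets with $I\cup J=[1\dots|w|]$, extended linearly, and $\epsilon:\mathcal H\to k$ by $\epsilon(1_{X^*})=1$ and $\epsilon(w)=0$ for every non-empty packed word $w$. Then $(\mathcal H,\Delta,\epsilon)$ is a coassociative coalgebra with counit, i.e. $(\Delta\otimes\mathrm{Id})\circ\Delta=(\mathrm{Id}\otimes\Delta)\circ\Delta$ and $(\epsilon\otimes\mathrm{Id})\circ\Delta=(\mathrm{Id}\otimes\epsilon)\circ\Delta=\mathrm{Id}$ (under the identifications $k\otimes\mathcal H\cong\mathcal H\cong\mathcal H\otimes k$).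
   Context: $X=\{x_i\}_{i\ge 0}$ is an alphabet totally ordered by index, $X^*$ the free monoid of words over $X$ with empty word $1_{X^*}$. For a word $w$, $|w|$ is its length, $w[i]$ its $i$-th letter, $IAlph(w)=\{i\in\mathbb N: x_i\text{ occurs in }w\}$, $Alph(w)=\{x_i: i\in IAlph(w)\}$. For $\phi$ on $IAlph(w)$ with values in $\mathbb N$ and $\phi(0)=0$, $S_\phi(x_{i_1}\cdots x_{i_m})=x_{\phi(i_1)}\cdots x_{\phi(i_m)}$. If $IAlph(w)\setminus\{0\}=\{j_1<\dots<j_k\}$, let $\phi_w(j_m)=m$, $\phi_w(0)=0$ and $pack(w)=S_{\phi_w}(w)$; $w$ is packed if $pack(w)=w$. For $I=\{i_1<\dots<i_l\}\subseteq[1\dots|w|]$, $w[I]=w[i_1]\cdots w[i_l]$. For $A\subseteq X$, $w/A=S_{\phi_A}(w)$ with $\phi_A(i)=0$ if $x_i\in A$, $\phi_A(i)=i$ otherwise; for words $w,u$, $w/u:=w/Alph(u)$. -}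

module Defs where

open import Level using (Level; suc; _⊔_)
open import Data.Bool using (Bool; true; false; not; if_then_else_)
open import Data.Nat as ℕ using (ℕ; zero; _≡ᵇ_)
open import Data.List using (List; []; _∷_; map; _++_; length; concatMap)
open import Data.Bool.ListAction using (any)
open import Data.List.Relation.Unary.All using (All)
open import Data.Product using (_×_; _,_; Σ; proj₂)
open import Relation.Binary.PropositionalEquality using (_≡_)
open import Relation.Binary.Definitions using (DecidableEquality)
open import Relation.Nullary using (¬_; does)
open import Algebra.Bundles using (CommutativeRing)

record Field (c ℓ : Level) : Set (Level.suc (c ⊔ ℓ)) where
  field
    commutativeRing : CommutativeRing c ℓ
  open CommutativeRing commutativeRing public
  field
    0≉1     : ¬ (0# ≈ 1#)
    inverse : ∀ x → ¬ (x ≈ 0#) → Σ Carrier λ y → x * y ≈ 1#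

-- Words over X = {x_i}: a letter x_i is represented by its index i.

Word : Set
Word = List ℕ

occurs : ℕ → Word → Bool
occurs i w = any (λ j → j ≡ᵇ i) w

-- rank w i = #{ j ∈ [1..i] | j ∈ IAlph(w) };  this is φ_w(i) for
-- i ∈ IAlph(w) (and rank w 0 = 0 = φ_w(0)).
rank : Word → ℕ → ℕ
rank w zero      = zero
rank w (ℕ.suc j) = (if occurs (ℕ.suc j) w then 1 else 0) ℕ.+ rank w j

pack : Word → Word
pack w = map (rank w) w

IsPacked : Word → Set
IsPacked w = pack w ≡ w

_/w_ : Word → Word → Word
w /w u = map (λ i → if occurs i u then 0 else i) w

-- A subset I ⊆ [1..|w|] is encoded by its characteristic mask
-- (position p is in I iff the p-th entry is true); w[I] selects.
select : List Bool → Word → Word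
select (true  ∷ m) (a ∷ w) = a ∷ select m w
select (false ∷ m) (a ∷ w) = select m w
select _ _ = []

-- all masks of length n, i.e. all subsets of [1..n]; the ordered pairs
-- (I , J) with I + J = [1..n] are (mask , complement of mask).
masks : ℕ → List (List Bool)
masks zero      = [] ∷ []
masks (ℕ.suc n) = map (true ∷_) (masks n) ++ map (false ∷_) (masks n)

-- Δ(w) on a (packed) word, as the list of its terms (each coefficient 1)
Δterms : Word → List (Word × Word)
Δterms w = map (λ I → let J = map not I in
                 pack (select I w) , pack (select J w /w select I w))
               (masks (length w))

-- Finite formal linear combinations over a field, compared coefficient-
-- wise (this is equality in the free vector space on A).

module Linear {c ℓ} (K : Field c ℓ) where
  open Field K

  LC : Set → Set c
  LC A = List (Carrier × A)

  coeff : {A : Set} → DecidableEquality A → LC A → A → Carrier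
  coeff _≟_ []             a = 0#
  coeff _≟_ ((k , b) ∷ xs) a =
    (if does (b ≟ a) then k else 0#) + coeff _≟_ xs a

  _≋[_]_ : {A : Set} → LC A → DecidableEquality A → LC A → Set ℓ
  x ≋[ eq ] y = ∀ a → coeff eq x a ≈ coeff eq y a

  -- elements of 𝓗 : linear combinations of packed words
  InH : LC Word → Set c
  InH x = All (λ p → IsPacked (proj₂ p)) x

  Δ : LC Word → LC (Word × Word)
  Δ = concatMap (λ { (k , w) → map (λ t → k , t) (Δterms w) })

  ε : Word → Carrier
  ε []      = 1#
  ε (_ ∷ _) = 0#

  -- (Δ ⊗ Id) and (Id ⊗ Δ) : 𝓗 ⊗ 𝓗 → 𝓗 ⊗ 𝓗 ⊗ 𝓗
  -- (both land in 𝓗 ⊗ 𝓗 ⊗ 𝓗 via the canonical associativity identification)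
  Δ⊗Id : LC (Word × Word) → LC (Word × Word × Word)
  Δ⊗Id = concatMap (λ { (k , (u , v)) →
           map (λ { (a , b) → k , (a , b , v) }) (Δterms u) })

  Id⊗Δ : LC (Word × Word) → LC (Word × Word × Word)
  Id⊗Δ = concatMap (λ { (k , (u , v)) →
           map (λ { (b , c') → k , (u , b , c') }) (Δterms v) })

  -- (ε ⊗ Id), (Id ⊗ ε) : 𝓗 ⊗ 𝓗 → 𝓗  (via k ⊗ 𝓗 ≅ 𝓗 ≅ 𝓗 ⊗ k)
  ε⊗Id : LC (Word × Word) → LC Word
  ε⊗Id = map (λ { (k , (u , v)) → k * ε u , v })

  Id⊗ε : LC (Word × Word) → LC Word
  Id⊗ε = map (λ { (k , (u , v)) → k * ε v , u })

open import Data.List.Properties using (≡-dec)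
import Data.Product.Properties as PP

_≟W_ : DecidableEquality Word
_≟W_ = ≡-dec ℕ._≟_

_≟W3_ : DecidableEquality (Word × Word × Word)
_≟W3_ = PP.≡-dec _≟W_ (PP.≡-dec _≟W_ _≟W_)

-- Each law is proved for the coproduct k·Δ(w) of one packed word and
-- then extended termwise to linear combinations.
--
-- A term of (Δ ⊗ Id)Δ(w) is indexed by I ⊆ [1..|w|] and
-- I₁ ⊆ I, a term of (Id ⊗ Δ)Δ(w) by I and J ⊆ ∁I; both index sets
-- correspond to the colourings of [1..|w|] by left / middle / right.
-- Corresponding terms are equal, by two facts established first:
-- packing is invariant under strictly monotone relabellings of the
-- letters fixing x₀ -- in particular pack(pack(Y)[I]) = pack(Y[I]) -- and
-- quotienting by a and then by b/a is quotienting by the letters of ab.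
-- Hence the two lists of terms are permutations of each other, and
-- coefficients are invariant under permutation.
--
-- Counit. Among the terms of Δ(w) only I = ∅ survives ε ⊗ Id and only
-- I = [1..|w|] survives Id ⊗ ε; as w is packed these terms are 1 ⊗ w
-- and w ⊗ 1.

module Submission where

open import Defs
open import Function using (_∘_)
open import Data.Bool using (Bool; true; false; not; if_then_else_; _∨_; _∧_)
open import Data.Bool.Properties using (∨-assoc; ∨-comm; ∨-zeroʳ; ∧-zeroʳ)
open import Data.Nat as ℕ using (ℕ; zero; suc; _≡ᵇ_; _≤ᵇ_; _<ᵇ_; _≤_; _<_; z≤n; s≤s)
open import Data.Nat.Properties as NP
  using (≡ᵇ⇒≡; ≡⇒≡ᵇ; ≤ᵇ-reflects-≤; ≤ᵇ⇒≤; ≤⇒≤ᵇ; <-cmp; ≤-refl; ≤-trans)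
open import Data.Sum using (_⊎_; inj₁; inj₂)
open import Data.Product using (_×_; _,_; proj₁; proj₂)
open import Data.List using (List; []; _∷_; map; _++_; length; concatMap; replicate)
import Data.List.Properties as LP
open import Data.List.Relation.Unary.All using (All; []; _∷_)
open import Data.List.Relation.Binary.Permutation.Propositional
  using (_↭_; ↭-reflexive; module PermutationReasoning)
import Data.List.Relation.Binary.Permutation.Propositional as ↭
import Data.List.Relation.Binary.Permutation.Propositional.Properties as Perm
import Data.List.Relation.Unary.All as All
import Data.List.Relation.Unary.All.Properties as AllP
open import Relation.Binary.PropositionalEquality
  using (_≡_; _≢_; refl; sym; trans; cong; cong₂; subst; module ≡-Reasoning)
open import Relation.Binary.Definitions using (tri<; tri≈; tri>; DecidableEquality)
import Relation.Binary.Reasoning.Setoid as SetoidReasoning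
open import Relation.Nullary using (yes; no; does; contradiction)
open import Relation.Nullary.Reflects using (Reflects; ofʸ; ofⁿ; fromEquivalence; det)

≡ᵇ-reflects : ∀ m n → Reflects (m ≡ n) (m ≡ᵇ n)
≡ᵇ-reflects m n = fromEquivalence (≡ᵇ⇒≡ m n) (≡⇒≡ᵇ m n)

≡ᵇ-refl : ∀ n → (n ≡ᵇ n) ≡ true
≡ᵇ-refl n = det (≡ᵇ-reflects n n) (ofʸ refl)

≡ᵇ-≢ : ∀ {m n} → m ≢ n → (m ≡ᵇ n) ≡ false
≡ᵇ-≢ {m} {n} m≢n = det (≡ᵇ-reflects m n) (ofⁿ m≢n)

≤ᵇ-refl : ∀ n → (n ≤ᵇ n) ≡ true
≤ᵇ-refl n = det (≤ᵇ-reflects-≤ n n) (ofʸ ≤-refl)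

≤ᵇ->  : ∀ {m n} → n < m → (m ≤ᵇ n) ≡ false
≤ᵇ-> {m} {n} n<m = det (≤ᵇ-reflects-≤ m n) (ofⁿ (NP.<⇒≱ n<m))

≤ᵇ-suc : ∀ {a j} → a ≢ suc j → (a ≤ᵇ suc j) ≡ (a ≤ᵇ j)
≤ᵇ-suc {a} {j} a≢1+j = det (≤ᵇ-reflects-≤ a (suc j))
  (fromEquivalence (NP.m≤n⇒m≤1+n ∘ ≤ᵇ⇒≤ a j)
                   (λ a≤1+j → ≤⇒≤ᵇ (NP.m<1+n⇒m≤n (NP.≤∧≢⇒< a≤1+j a≢1+j))))

count : Bool → ℕ
count b = if b then 1 else 0

newLetterUpTo : ℕ → Word → ℕ → Bool
newLetterUpTo a u i = not (occurs a u) ∧ ((0 <ᵇ a) ∧ (a ≤ᵇ i))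

count-swap : ∀ b c r → count b ℕ.+ (count c ℕ.+ r) ≡ count c ℕ.+ (count b ℕ.+ r)
count-swap false c r = refl
count-swap true false r = refl
count-swap true true r = refl

count-complement : ∀ b r → count (not b ∧ true) ℕ.+ (count b ℕ.+ r) ≡ suc r
count-complement false r = refl
count-complement true r = refl

rank-∷ : ∀ a u i → rank (a ∷ u) i ≡ count (newLetterUpTo a u i) ℕ.+ rank u i
rank-∷ zero u zero = cong (λ b → count b ℕ.+ 0) (sym (∧-zeroʳ (not (occurs 0 u))))
rank-∷ (suc a) u zero = cong (λ b → count b ℕ.+ 0) (sym (∧-zeroʳ (not (occurs (suc a) u))))
rank-∷ a u (suc j) with a ℕ.≟ suc j
... | yes refl =
  begin
    count ((suc j ≡ᵇ suc j) ∨ o) ℕ.+ rank (suc j ∷ u) j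
  ≡⟨ cong₂ (λ b r → count (b ∨ o) ℕ.+ r) (≡ᵇ-refl (suc j)) (rank-∷ (suc j) u j) ⟩
    suc (count (not o ∧ (suc j ≤ᵇ j)) ℕ.+ rank u j)
  ≡⟨ cong (λ b → suc (count (not o ∧ b) ℕ.+ rank u j)) (≤ᵇ-> (NP.n<1+n j)) ⟩
    suc (count (not o ∧ false) ℕ.+ rank u j)
  ≡⟨ cong (λ b → suc (count b ℕ.+ rank u j)) (∧-zeroʳ (not o)) ⟩
    suc (rank u j)
  ≡⟨ sym (count-complement o (rank u j)) ⟩
    count (not o ∧ true) ℕ.+ (count o ℕ.+ rank u j)
  ≡⟨ cong (λ b → count (not o ∧ b) ℕ.+ rank u (suc j)) (sym (≤ᵇ-refl (suc j))) ⟩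
    count (newLetterUpTo (suc j) u (suc j)) ℕ.+ rank u (suc j)
  ∎
  where open ≡-Reasoning
        o = occurs (suc j) u
... | no a≢1+j =
  begin
    count ((a ≡ᵇ suc j) ∨ o) ℕ.+ rank (a ∷ u) j
  ≡⟨ cong₂ (λ b r → count (b ∨ o) ℕ.+ r) (≡ᵇ-≢ a≢1+j) (rank-∷ a u j) ⟩
    count o ℕ.+ (count (newLetterUpTo a u j) ℕ.+ rank u j)
  ≡⟨ count-swap o _ (rank u j) ⟩
    count (newLetterUpTo a u j) ℕ.+ rank u (suc j)
  ≡⟨ cong (λ b → count (not (occurs a u) ∧ ((0 <ᵇ a) ∧ b)) ℕ.+ rank u (suc j))
          (sym (≤ᵇ-suc a≢1+j)) ⟩
    count (newLetterUpTo a u (suc j)) ℕ.+ rank u (suc j)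
  ∎
  where open ≡-Reasoning
        o = occurs (suc j) u

quotientLetter : Word → ℕ → ℕ
quotientLetter t i = if occurs i t then 0 else i

-- Packing is invariant under strictly monotone relabellings.

record Admissible (P : ℕ → Set) (g : ℕ → ℕ) : Set where
  field
    zero-ok  : P 0
    fixes-0  : g 0 ≡ 0
    strictly : ∀ {i j} → P i → P j → i < j → g i < g j

module Relabelling {P : ℕ → Set} {g : ℕ → ℕ} (adm : Admissible P g) where
  open Admissible adm

  injective : ∀ {i j} → P i → P j → g i ≡ g j → i ≡ j
  injective {i} {j} pi pj gi≡gj with <-cmp i j
  ... | tri< i<j _ _ = contradiction gi≡gj (NP.<⇒≢ (strictly pi pj i<j))
  ... | tri≈ _ i≡j _ = i≡j
  ... | tri> _ _ j<i = contradiction (sym gi≡gj) (NP.<⇒≢ (strictly pj pi j<i))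

  monotone : ∀ {i j} → P i → P j → i ≤ j → g i ≤ g j
  monotone pi pj i≤j with NP.m≤n⇒m<n∨m≡n i≤j
  ... | inj₁ i<j  = NP.<⇒≤ (strictly pi pj i<j)
  ... | inj₂ refl = ≤-refl

  reflects-order : ∀ {i j} → P i → P j → g i ≤ g j → i ≤ j
  reflects-order pi pj gi≤gj = NP.≮⇒≥ (λ j<i → NP.<⇒≱ (strictly pj pi j<i) gi≤gj)

  -- hence every Boolean comparison used by rank is unchanged by g
  ≡ᵇ-preserved : ∀ {i j} → P i → P j → (g i ≡ᵇ g j) ≡ (i ≡ᵇ j)
  ≡ᵇ-preserved {i} {j} pi pj = det
    (fromEquivalence (injective pi pj ∘ ≡ᵇ⇒≡ (g i) (g j)) (≡⇒≡ᵇ (g i) (g j) ∘ cong g))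
    (≡ᵇ-reflects i j)

  ≤ᵇ-preserved : ∀ {i j} → P i → P j → (g i ≤ᵇ g j) ≡ (i ≤ᵇ j)
  ≤ᵇ-preserved {i} {j} pi pj = det
    (fromEquivalence (reflects-order pi pj ∘ ≤ᵇ⇒≤ (g i) (g j)) (≤⇒≤ᵇ ∘ monotone pi pj))
    (≤ᵇ-reflects-≤ i j)

  positivity-preserved : ∀ {i} → P i → (0 <ᵇ g i) ≡ (0 <ᵇ i)
  positivity-preserved {zero}  _  = cong (0 <ᵇ_) fixes-0
  positivity-preserved {suc i} pi =
    det (NP.<ᵇ-reflects-< 0 (g (suc i)))
        (ofʸ (subst (_< g (suc i)) fixes-0 (strictly zero-ok pi (s≤s z≤n))))

  occurs-preserved : ∀ {i} u → P i → All P u → occurs (g i) (map g u) ≡ occurs i u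
  occurs-preserved []      pi []         = refl
  occurs-preserved (a ∷ u) pi (pa ∷ pu) = cong₂ _∨_ (≡ᵇ-preserved pa pi) (occurs-preserved u pi pu)

  rank-preserved : ∀ {i} u → All P u → P i → rank (map g u) (g i) ≡ rank u i
  rank-preserved {i} [] [] pi = trans (rank-[] (g i)) (sym (rank-[] i))
    where
    rank-[] : ∀ n → rank [] n ≡ 0
    rank-[] zero    = refl
    rank-[] (suc n) = rank-[] n
  rank-preserved {i} (a ∷ u) (pa ∷ pu) pi =
    begin
      rank (g a ∷ map g u) (g i)
    ≡⟨ rank-∷ (g a) (map g u) (g i) ⟩
      count (newLetterUpTo (g a) (map g u) (g i)) ℕ.+ rank (map g u) (g i)
    ≡⟨ cong₂ (λ b r → count b ℕ.+ r) new-preserved (rank-preserved u pu pi) ⟩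
      count (newLetterUpTo a u i) ℕ.+ rank u i
    ≡⟨ sym (rank-∷ a u i) ⟩
      rank (a ∷ u) i
    ∎
    where
    open ≡-Reasoning
    new-preserved : newLetterUpTo (g a) (map g u) (g i) ≡ newLetterUpTo a u i
    new-preserved = cong₂ (λ o b → not o ∧ b) (occurs-preserved u pa pu)
                      (cong₂ _∧_ (positivity-preserved pa) (≤ᵇ-preserved pa pi))

  pack-relabel : ∀ u → All P u → pack (map g u) ≡ pack u
  pack-relabel u pu =
    trans (sym (LP.map-∘ u)) (LP.map-cong-local (All.map (rank-preserved u pu) pu))

  quotient-relabel : ∀ s t → All P s → All P t → (map g s /w map g t) ≡ map g (s /w t)
  quotient-relabel s t ps pt =
    trans (sym (LP.map-∘ s)) (trans (LP.map-cong-local (All.map letter ps)) (LP.map-∘ s))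
    where
    letter : ∀ {a} → P a → quotientLetter (map g t) (g a) ≡ g (quotientLetter t a)
    letter {a} pa rewrite occurs-preserved t pa pt with occurs a t
    ... | true  = sym fixes-0
    ... | false = refl

-- pack Y relabels Y by rank Y, which is admissible on the letters of Y.

LetterOf : Word → ℕ → Set
LetterOf Y x = x ≡ 0 ⊎ occurs x Y ≡ true

rank-monotone : ∀ Y {i j} → i ≤ j → rank Y i ≤ rank Y j
rank-monotone Y {zero}  _ = z≤n
rank-monotone Y {suc i} {suc j} i≤j with NP.m≤n⇒m<n∨m≡n i≤j
... | inj₁ i<j  = ≤-trans (rank-monotone Y {suc i} {j} (NP.≤-pred i<j)) (NP.m≤n+m (rank Y j) _)
... | inj₂ refl = ≤-refl

rank-strictly : ∀ Y {i j} → LetterOf Y i → LetterOf Y j → i < j → rank Y i < rank Y j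
rank-strictly Y {j = suc j} _ (inj₂ occ) i<j rewrite occ = s≤s (rank-monotone Y (NP.≤-pred i<j))

rank-admissible : ∀ Y → Admissible (LetterOf Y) (rank Y)
rank-admissible Y = record
  { zero-ok = inj₁ refl ; fixes-0 = refl ; strictly = rank-strictly Y }

letters-of-self : ∀ Y → All (LetterOf Y) Y
letters-of-self []      = []
letters-of-self (a ∷ Y) =
  inj₂ (cong (_∨ occurs a Y) (≡ᵇ-refl a)) ∷ All.map widen (letters-of-self Y)
  where
  widen : ∀ {x} → LetterOf Y x → LetterOf (a ∷ Y) x
  widen (inj₁ x≡0) = inj₁ x≡0
  widen (inj₂ occ) = inj₂ (trans (cong ((a ≡ᵇ _) ∨_) occ) (∨-zeroʳ _))

select-All : ∀ {P : ℕ → Set} m w → All P w → All P (select m w)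
select-All (true  ∷ m) (a ∷ w) (pa ∷ pw) = pa ∷ select-All m w pw
select-All (false ∷ m) (a ∷ w) (pa ∷ pw) = select-All m w pw
select-All []          w       pw        = []
select-All (true  ∷ m) []      pw        = []
select-All (false ∷ m) []      pw        = []

quotient-All : ∀ {P : ℕ → Set} → P 0 → ∀ s t → All P s → All P (s /w t)
quotient-All p0 []      t []        = []
quotient-All p0 (a ∷ s) t (pa ∷ ps) with occurs a t
... | true  = p0 ∷ quotient-All p0 s t ps
... | false = pa ∷ quotient-All p0 s t ps

select-map : ∀ (f : ℕ → ℕ) m w → select m (map f w) ≡ map f (select m w)
select-map f (true  ∷ m) (a ∷ w) = cong (f a ∷_) (select-map f m w)
select-map f (false ∷ m) (a ∷ w) = select-map f m w
select-map f []          w       = refl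
select-map f (true  ∷ m) []      = refl
select-map f (false ∷ m) []      = refl

pack-select-pack : ∀ m Y → pack (select m (pack Y)) ≡ pack (select m Y)
pack-select-pack m Y =
  trans (cong pack (select-map (rank Y) m Y))
        (pack-relabel (select m Y) (select-All m Y (letters-of-self Y)))
  where open Relabelling (rank-admissible Y)

pack-quotient-pack : ∀ m m′ Y →
  pack (select m (pack Y) /w select m′ (pack Y)) ≡ pack (select m Y /w select m′ Y)
pack-quotient-pack m m′ Y =
  begin
    pack (select m (pack Y) /w select m′ (pack Y))
  ≡⟨ cong₂ (λ s t → pack (s /w t)) (select-map (rank Y) m Y) (select-map (rank Y) m′ Y) ⟩
    pack (map (rank Y) (select m Y) /w map (rank Y) (select m′ Y))
  ≡⟨ cong pack (quotient-relabel (select m Y) (select m′ Y) (letters m) (letters m′)) ⟩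
    pack (map (rank Y) (select m Y /w select m′ Y))
  ≡⟨ pack-relabel _ (quotient-All (inj₁ refl) (select m Y) (select m′ Y) (letters m)) ⟩
    pack (select m Y /w select m′ Y)
  ∎
  where
  open ≡-Reasoning
  open Relabelling (rank-admissible Y)
  letters : ∀ m → All (LetterOf Y) (select m Y)
  letters m = select-All m Y (letters-of-self Y)

if-same : ∀ b (n : ℕ) → (if b then n else n) ≡ n
if-same true  n = refl
if-same false n = refl

occurs-quotient : ∀ {x} b a → x ≢ 0 → occurs x a ≡ false → occurs x (b /w a) ≡ occurs x b
occurs-quotient     []      a x≢0 x∉a = refl
occurs-quotient {x} (y ∷ b) a x≢0 x∉a = cong₂ _∨_ head (occurs-quotient b a x≢0 x∉a)
  where
  head : (quotientLetter a y ≡ᵇ x) ≡ (y ≡ᵇ x)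
  head with occurs y a in y∈a | y ℕ.≟ x
  ... | false | _      = refl
  ... | true  | yes refl with () ← trans (sym x∉a) y∈a
  ... | true  | no y≢x = trans (≡ᵇ-≢ (x≢0 ∘ sym)) (sym (≡ᵇ-≢ y≢x))

quotient-quotient : ∀ c a b Y → (∀ x → occurs x Y ≡ (occurs x a ∨ occurs x b)) →
  ((c /w a) /w (b /w a)) ≡ (c /w Y)
quotient-quotient c a b Y Y≡a∪b =
  trans (sym (LP.map-∘ c)) (LP.map-cong letter c)
  where
  letter : ∀ x → quotientLetter (b /w a) (quotientLetter a x) ≡ quotientLetter Y x
  letter x rewrite Y≡a∪b x with occurs x a in x∈a | x ℕ.≟ 0
  ... | true  | _      = if-same (occurs 0 (b /w a)) 0
  ... | false | yes refl = trans (if-same (occurs 0 (b /w a)) 0) (sym (if-same (occurs 0 b) 0))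
  ... | false | no x≢0 rewrite occurs-quotient b a x≢0 x∈a = refl

-- A colouring t determines
-- the terms indexed by (I , I₁) in (Δ ⊗ Id)Δ and by (I , J) in (Id ⊗ Δ)Δ:
-- the positions coloured left / middle / right go to the first / second /
-- third tensor factor.

data Colour : Set where
  left middle right : Colour

isLeft isMiddle isRight : Colour → Bool
isLeft left = true
isLeft _    = false
isMiddle middle = true
isMiddle _      = false
isRight right = true
isRight _     = false

submask : (Colour → Bool) → (Colour → Bool) → List Colour → List Bool
submask p q []      = []
submask p q (c ∷ t) = if p c then q c ∷ submask p q t else submask p q t

-- (select recurses on the mask first, so this needs a proof)
select-[] : ∀ m → select m [] ≡ []
select-[] []          = refl
select-[] (true  ∷ m) = refl
select-[] (false ∷ m) = refl

select-submask : ∀ p q t w →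
  select (submask p q t) (select (map p t) w) ≡ select (map (λ c → p c ∧ q c) t) w
select-submask p q []      w       = refl
select-submask p q (c ∷ t) []      =
  trans (cong (select (submask p q (c ∷ t))) (select-[] (map p (c ∷ t))))
        (trans (select-[] (submask p q (c ∷ t))) (sym (select-[] (map (λ c → p c ∧ q c) (c ∷ t)))))
select-submask p q (c ∷ t) (a ∷ w) with p c | q c
... | true  | true  = cong (a ∷_) (select-submask p q t w)
... | true  | false = select-submask p q t w
... | false | _     = select-submask p q t w

map-not-submask : ∀ p q t → map not (submask p q t) ≡ submask p (not ∘ q) t
map-not-submask p q []      = refl
map-not-submask p q (c ∷ t) with p c
... | true  = cong (not (q c) ∷_) (map-not-submask p q t)
... | false = map-not-submask p q t

select-mask-cong : ∀ {p q : Colour → Bool} → (∀ c → p c ≡ q c) → ∀ t w →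
  select (map p t) w ≡ select (map q t) w
select-mask-cong p≗q t w = cong (λ m → select m w) (LP.map-cong p≗q t)

select-complement : ∀ (p : Colour → Bool) t w →
  select (map not (map p t)) w ≡ select (map (not ∘ p) t) w
select-complement p t w = cong (λ m → select m w) (sym (LP.map-∘ {g = not} {f = p} t))

Δterm : Word → List Bool → Word × Word
Δterm w I = pack (select I w) , pack (select (map not I) w /w select I w)

IndexPair : Set
IndexPair = List Bool × List Bool

leftTerm : Word → IndexPair → Word × Word × Word
leftTerm w (I , I₁) = proj₁ (Δterm u I₁) , proj₂ (Δterm u I₁) , proj₂ (Δterm w I)
  where u = proj₁ (Δterm w I)

rightTerm : Word → IndexPair → Word × Word × Word
rightTerm w (I , J) = proj₁ (Δterm w I) , Δterm (proj₂ (Δterm w I)) J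

leftIndex : List Colour → IndexPair
leftIndex t = map (not ∘ isRight) t , submask (not ∘ isRight) isLeft t

rightIndex : List Colour → IndexPair
rightIndex t = map isLeft t , submask (not ∘ isLeft) isMiddle t

occurs-left-middle : ∀ x t w → occurs x (select (map (not ∘ isRight) t) w)
  ≡ (occurs x (select (map isLeft t) w) ∨ occurs x (select (map isMiddle t) w))
occurs-left-middle x [] w = refl
occurs-left-middle x (c ∷ t) [] rewrite select-[] (map (not ∘ isRight) (c ∷ t))
  | select-[] (map isLeft (c ∷ t)) | select-[] (map isMiddle (c ∷ t)) = refl
occurs-left-middle x (left ∷ t) (a ∷ w) rewrite occurs-left-middle x t w =
  sym (∨-assoc (a ≡ᵇ x) _ _)
occurs-left-middle x (middle ∷ t) (a ∷ w) rewrite occurs-left-middle x t w =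
  trans (sym (∨-assoc (a ≡ᵇ x) oL oM))
        (trans (cong (_∨ oM) (∨-comm (a ≡ᵇ x) oL)) (∨-assoc oL (a ≡ᵇ x) oM))
  where oL = occurs x (select (map isLeft t) w)
        oM = occurs x (select (map isMiddle t) w)
occurs-left-middle x (right ∷ t) (a ∷ w) = occurs-left-middle x t w

-- Corresponding terms of (Δ ⊗ Id)Δ(w) and (Id ⊗ Δ)Δ(w) are equal: both
-- are (pack L , pack (M / L) , pack ((R / L) / (M / L))) for the words
-- L, M, R read off the left, middle and right positions.
leftTerm≡rightTerm : ∀ w t → leftTerm w (leftIndex t) ≡ rightTerm w (rightIndex t)
leftTerm≡rightTerm w t = cong₂ _,_ first (cong₂ _,_ second third)
  where
  open ≡-Reasoning
  -- Y : left and middle positions (first factor of Δ on the left side);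
  -- Z : middle and right positions, so Z / L is the second factor of Δ
  -- on the right side; I₁ and J locate L in Y and M in Z.
  L = select (map isLeft t) w
  M = select (map isMiddle t) w
  R = select (map isRight t) w
  Y = select (map (not ∘ isRight) t) w
  Z = select (map not (map isLeft t)) w
  I₁ = submask (not ∘ isRight) isLeft t
  J = submask (not ∘ isLeft) isMiddle t
  X = Z /w L

  Y-left : select I₁ Y ≡ L
  Y-left = trans (select-submask _ _ t w)
                 (select-mask-cong (λ { left → refl ; middle → refl ; right → refl }) t w)

  Y-middle : select (map not I₁) Y ≡ M
  Y-middle = trans (cong (λ m → select m Y) (map-not-submask _ _ t))
             (trans (select-submask _ _ t w)
                    (select-mask-cong (λ { left → refl ; middle → refl ; right → refl }) t w))

  Z-middle : select J Z ≡ M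
  Z-middle = trans (cong (select J) (select-complement isLeft t w)) (trans (select-submask _ _ t w)
                   (select-mask-cong (λ { left → refl ; middle → refl ; right → refl }) t w))

  Z-right : select (map not J) Z ≡ R
  Z-right = trans (cong₂ select (map-not-submask _ _ t) (select-complement isLeft t w))
            (trans (select-submask _ _ t w)
                   (select-mask-cong (λ { left → refl ; middle → refl ; right → refl }) t w))

  not-Y-right : select (map not (map (not ∘ isRight) t)) w ≡ R
  not-Y-right = trans (select-complement (not ∘ isRight) t w)
                      (select-mask-cong (λ { left → refl ; middle → refl ; right → refl }) t w)

  X-select : ∀ m → select m X ≡ select m Z /w L
  X-select m = select-map (quotientLetter L) m Z

  first : pack (select I₁ (pack Y)) ≡ pack L
  first = trans (pack-select-pack I₁ Y) (cong pack Y-left)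

  second : pack (select (map not I₁) (pack Y) /w select I₁ (pack Y)) ≡ pack (select J (pack X))
  second =
    begin
      pack (select (map not I₁) (pack Y) /w select I₁ (pack Y))
    ≡⟨ pack-quotient-pack (map not I₁) I₁ Y ⟩
      pack (select (map not I₁) Y /w select I₁ Y)
    ≡⟨ cong₂ (λ s u → pack (s /w u)) Y-middle Y-left ⟩
      pack (M /w L)
    ≡⟨ cong (λ s → pack (s /w L)) (sym Z-middle) ⟩
      pack (select J Z /w L)
    ≡⟨ cong pack (sym (X-select J)) ⟩
      pack (select J X)
    ≡⟨ sym (pack-select-pack J X) ⟩
      pack (select J (pack X))
    ∎

  third : pack (select (map not (map (not ∘ isRight) t)) w /w Y)
        ≡ pack (select (map not J) (pack X) /w select J (pack X))
  third =
    begin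
      pack (select (map not (map (not ∘ isRight) t)) w /w Y)
    ≡⟨ cong (λ s → pack (s /w Y)) not-Y-right ⟩
      pack (R /w Y)
    ≡⟨ cong pack (sym (quotient-quotient R L M Y (λ x → occurs-left-middle x t w))) ⟩
      pack ((R /w L) /w (M /w L))
    ≡⟨ cong₂ (λ s u → pack ((s /w L) /w (u /w L))) (sym Z-right) (sym Z-middle) ⟩
      pack ((select (map not J) Z /w L) /w (select J Z /w L))
    ≡⟨ cong₂ (λ s u → pack (s /w u)) (sym (X-select (map not J))) (sym (X-select J)) ⟩
      pack (select (map not J) X /w select J X)
    ≡⟨ sym (pack-quotient-pack (map not J) J X) ⟩
      pack (select (map not J) (pack X) /w select J (pack X))
    ∎

colourings : ℕ → List (List Colour)
colourings zero    = [] ∷ []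
colourings (suc n) = map (left ∷_) cs ++ map (middle ∷_) cs ++ map (right ∷_) cs
  where cs = colourings n

leftIndices : Word → List IndexPair
leftIndices w = concatMap (λ I → map (I ,_) (masks (length (select I w)))) (masks (length w))

rightIndices : Word → List IndexPair
rightIndices w =
  concatMap (λ I → map (I ,_) (masks (length (select (map not I) w)))) (masks (length w))

map-map-cong : ∀ {a b c d} {A : Set a} {B : Set b} {C : Set c} {D : Set d}
  {f : B → D} {g : A → B} {h : C → D} {k : A → C} →
  (∀ x → f (g x) ≡ h (k x)) → ∀ xs → map f (map g xs) ≡ map h (map k xs)
map-map-cong fg≗hk xs =
  trans (sym (LP.map-∘ xs)) (trans (LP.map-cong fg≗hk xs) (LP.map-∘ xs))

concatMap-++-↭ : ∀ {A B : Set} (f g : A → List B) xs →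
  concatMap (λ x → f x ++ g x) xs ↭ concatMap f xs ++ concatMap g xs
concatMap-++-↭ f g []       = ↭-reflexive refl
concatMap-++-↭ f g (x ∷ xs) =
  begin
    (f x ++ g x) ++ concatMap (λ x → f x ++ g x) xs
  ≡⟨ LP.++-assoc (f x) (g x) _ ⟩
    f x ++ g x ++ concatMap (λ x → f x ++ g x) xs
  ↭⟨ Perm.++⁺ˡ (f x) (Perm.++⁺ˡ (g x) (concatMap-++-↭ f g xs)) ⟩
    f x ++ g x ++ concatMap f xs ++ concatMap g xs
  ↭⟨ Perm.++⁺ˡ (f x) (Perm.shifts (g x) (concatMap f xs)) ⟩
    f x ++ concatMap f xs ++ g x ++ concatMap g xs
  ≡⟨ LP.++-assoc (f x) (concatMap f xs) _ ⟨
    (f x ++ concatMap f xs) ++ g x ++ concatMap g xs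
  ∎
  where open PermutationReasoning

leftExtend : Colour → IndexPair → IndexPair
leftExtend left   (I , I₁) = true ∷ I  , true ∷ I₁
leftExtend middle (I , I₁) = true ∷ I  , false ∷ I₁
leftExtend right  (I , I₁) = false ∷ I , I₁

rightExtend : Colour → IndexPair → IndexPair
rightExtend left   (I , J) = true ∷ I  , J
rightExtend middle (I , J) = false ∷ I , true ∷ J
rightExtend right  (I , J) = false ∷ I , false ∷ J

↭-colourings : ∀ {A : Set} (S : Word → List A) (index : List Colour → A) (extend : Colour → A → A) →
  (∀ c t → index (c ∷ t) ≡ extend c (index t)) →
  S [] ≡ index [] ∷ [] →
  (∀ a w → S (a ∷ w) ↭ map (extend left) (S w) ++ map (extend middle) (S w) ++ map (extend right) (S w)) →
  ∀ w → S w ↭ map index (colourings (length w))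
↭-colourings S index extend index-∷ S[] S∷ [] = ↭-reflexive S[]
↭-colourings S index extend index-∷ S[] S∷ (a ∷ w) =
  begin
    S (a ∷ w)
  ↭⟨ S∷ a w ⟩
    map (extend left) (S w) ++ map (extend middle) (S w) ++ map (extend right) (S w)
  ↭⟨ Perm.++⁺ (Perm.map⁺ _ ih) (Perm.++⁺ (Perm.map⁺ _ ih) (Perm.map⁺ _ ih)) ⟩
    map (extend left) (map index cs) ++ map (extend middle) (map index cs) ++ map (extend right) (map index cs)
  ≡⟨ cong₂ _++_ (map-map-cong (sym ∘ index-∷ left) cs)
       (cong₂ _++_ (map-map-cong (sym ∘ index-∷ middle) cs) (map-map-cong (sym ∘ index-∷ right) cs)) ⟩
    map index (map (left ∷_) cs) ++ map index (map (middle ∷_) cs) ++ map index (map (right ∷_) cs)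
  ≡⟨ cong (map index (map (left ∷_) cs) ++_) (LP.map-++ index (map (middle ∷_) cs) _) ⟨
    map index (map (left ∷_) cs) ++ map index (map (middle ∷_) cs ++ map (right ∷_) cs)
  ≡⟨ LP.map-++ index (map (left ∷_) cs) _ ⟨
    map index (colourings (length (a ∷ w)))
  ∎
  where
  open PermutationReasoning
  cs = colourings (length w)
  ih = ↭-colourings S index extend index-∷ S[] S∷ w

leftIndices-∷ : ∀ a w → leftIndices (a ∷ w) ↭
  map (leftExtend left) (leftIndices w) ++ map (leftExtend middle) (leftIndices w)
    ++ map (leftExtend right) (leftIndices w)
leftIndices-∷ a w =
  begin
    concatMap F (map (true ∷_) M ++ map (false ∷_) M)
  ≡⟨ LP.concatMap-++ F (map (true ∷_) M) _ ⟩
    concatMap F (map (true ∷_) M) ++ concatMap F (map (false ∷_) M)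
  ≡⟨ cong₂ _++_ (trans (LP.concatMap-map F _ M) (LP.concatMap-cong split M))
       (trans (LP.concatMap-map F _ M)
              (trans (LP.concatMap-cong shift M) (sym (LP.map-concatMap (leftExtend right) K M)))) ⟩
    concatMap (λ I → map (leftExtend left) (K I) ++ map (leftExtend middle) (K I)) M
      ++ map (leftExtend right) (leftIndices w)
  ↭⟨ Perm.++⁺ʳ _ (concatMap-++-↭ (map (leftExtend left) ∘ K) (map (leftExtend middle) ∘ K) M) ⟩
    (concatMap (map (leftExtend left) ∘ K) M ++ concatMap (map (leftExtend middle) ∘ K) M)
      ++ map (leftExtend right) (leftIndices w)
  ≡⟨ cong₂ (λ p q → (p ++ q) ++ map (leftExtend right) (leftIndices w))
       (LP.map-concatMap (leftExtend left) K M) (LP.map-concatMap (leftExtend middle) K M) ⟨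
    (map (leftExtend left) (leftIndices w) ++ map (leftExtend middle) (leftIndices w))
      ++ map (leftExtend right) (leftIndices w)
  ≡⟨ LP.++-assoc (map (leftExtend left) (leftIndices w)) _ _ ⟩
    map (leftExtend left) (leftIndices w) ++ map (leftExtend middle) (leftIndices w)
      ++ map (leftExtend right) (leftIndices w)
  ∎
  where
  open PermutationReasoning
  M : List (List Bool)
  M = masks (length w)
  K : List Bool → List IndexPair
  K I = map (I ,_) (masks (length (select I w)))
  F : List Bool → List IndexPair
  F I = map (I ,_) (masks (length (select I (a ∷ w))))
  split : ∀ I → F (true ∷ I) ≡ map (leftExtend left) (K I) ++ map (leftExtend middle) (K I)
  split I = trans (LP.map-++ _ (map (true ∷_) ms) _)
                  (cong₂ _++_ (map-map-cong (λ _ → refl) ms) (map-map-cong (λ _ → refl) ms))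
    where ms = masks (length (select I w))
  shift : ∀ I → F (false ∷ I) ≡ map (leftExtend right) (K I)
  shift I = LP.map-∘ (masks (length (select I w)))

rightIndices-∷ : ∀ a w → rightIndices (a ∷ w) ↭
  map (rightExtend left) (rightIndices w) ++ map (rightExtend middle) (rightIndices w)
    ++ map (rightExtend right) (rightIndices w)
rightIndices-∷ a w =
  begin
    concatMap F (map (true ∷_) M ++ map (false ∷_) M)
  ≡⟨ LP.concatMap-++ F (map (true ∷_) M) _ ⟩
    concatMap F (map (true ∷_) M) ++ concatMap F (map (false ∷_) M)
  ≡⟨ cong₂ _++_
       (trans (LP.concatMap-map F _ M)
              (trans (LP.concatMap-cong shift M) (sym (LP.map-concatMap (rightExtend left) K M))))
       (trans (LP.concatMap-map F _ M) (LP.concatMap-cong split M)) ⟩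
    map (rightExtend left) (rightIndices w)
      ++ concatMap (λ I → map (rightExtend middle) (K I) ++ map (rightExtend right) (K I)) M
  ↭⟨ Perm.++⁺ˡ _ (concatMap-++-↭ (map (rightExtend middle) ∘ K) (map (rightExtend right) ∘ K) M) ⟩
    map (rightExtend left) (rightIndices w)
      ++ concatMap (map (rightExtend middle) ∘ K) M ++ concatMap (map (rightExtend right) ∘ K) M
  ≡⟨ cong₂ (λ p q → map (rightExtend left) (rightIndices w) ++ p ++ q)
       (LP.map-concatMap (rightExtend middle) K M) (LP.map-concatMap (rightExtend right) K M) ⟨
    map (rightExtend left) (rightIndices w) ++ map (rightExtend middle) (rightIndices w)
      ++ map (rightExtend right) (rightIndices w)
  ∎
  where
  open PermutationReasoning
  M : List (List Bool)
  M = masks (length w)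
  K : List Bool → List IndexPair
  K I = map (I ,_) (masks (length (select (map not I) w)))
  F : List Bool → List IndexPair
  F I = map (I ,_) (masks (length (select (map not I) (a ∷ w))))
  shift : ∀ I → F (true ∷ I) ≡ map (rightExtend left) (K I)
  shift I = LP.map-∘ (masks (length (select (map not I) w)))
  split : ∀ I → F (false ∷ I) ≡ map (rightExtend middle) (K I) ++ map (rightExtend right) (K I)
  split I = trans (LP.map-++ _ (map (true ∷_) ms) _)
                  (cong₂ _++_ (map-map-cong (λ _ → refl) ms) (map-map-cong (λ _ → refl) ms))
    where ms = masks (length (select (map not I) w))

leftIndices-↭ : ∀ w → leftIndices w ↭ map leftIndex (colourings (length w))
leftIndices-↭ = ↭-colourings leftIndices leftIndex leftExtend
  (λ { left t → refl ; middle t → refl ; right t → refl }) refl leftIndices-∷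

rightIndices-↭ : ∀ w → rightIndices w ↭ map rightIndex (colourings (length w))
rightIndices-↭ = ↭-colourings rightIndices rightIndex rightExtend
  (λ { left t → refl ; middle t → refl ; right t → refl }) refl rightIndices-∷

nonemptyMasks : Word → List (List Bool)
nonemptyMasks []      = []
nonemptyMasks (a ∷ w) = map (true ∷_) (masks (length w)) ++ map (false ∷_) (nonemptyMasks w)

properMasks : Word → List (List Bool)
properMasks []      = []
properMasks (a ∷ w) = map (true ∷_) (properMasks w) ++ map (false ∷_) (masks (length w))

masks-nonempty : ∀ w → masks (length w) ≡ nonemptyMasks w ++ replicate (length w) false ∷ []
masks-nonempty []      = refl
masks-nonempty (a ∷ w) =
  begin
    map (true ∷_) M ++ map (false ∷_) (masks (length w))
  ≡⟨ cong (λ L → map (true ∷_) M ++ map (false ∷_) L) (masks-nonempty w) ⟩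
    map (true ∷_) M ++ map (false ∷_) (nonemptyMasks w ++ replicate (length w) false ∷ [])
  ≡⟨ cong (map (true ∷_) M ++_) (LP.map-++ (false ∷_) (nonemptyMasks w) _) ⟩
    map (true ∷_) M ++ map (false ∷_) (nonemptyMasks w) ++ replicate (suc (length w)) false ∷ []
  ≡⟨ LP.++-assoc (map (true ∷_) M) _ _ ⟨
    nonemptyMasks (a ∷ w) ++ replicate (length (a ∷ w)) false ∷ []
  ∎
  where
  open ≡-Reasoning
  M = masks (length w)

masks-proper : ∀ w → masks (length w) ≡ replicate (length w) true ∷ properMasks w
masks-proper []      = refl
masks-proper (a ∷ w) =
  cong (λ L → map (true ∷_) L ++ map (false ∷_) (masks (length w))) (masks-proper w)

nonemptyMasks-select : ∀ w → All (λ I → 0 < length (select I w)) (nonemptyMasks w)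
nonemptyMasks-select []      = []
nonemptyMasks-select (a ∷ w) =
  AllP.++⁺ (AllP.map⁺ (All.universal (λ _ → s≤s z≤n) (masks (length w))))
           (AllP.map⁺ (nonemptyMasks-select w))

properMasks-select : ∀ w → All (λ I → 0 < length (select (map not I) w)) (properMasks w)
properMasks-select []      = []
properMasks-select (a ∷ w) =
  AllP.++⁺ (AllP.map⁺ (properMasks-select w))
           (AllP.map⁺ (All.universal (λ _ → s≤s z≤n) (masks (length w))))

select-none : ∀ w → select (replicate (length w) false) w ≡ []
select-none []      = refl
select-none (a ∷ w) = select-none w

select-all : ∀ w → select (replicate (length w) true) w ≡ w
select-all []      = refl
select-all (a ∷ w) = cong (a ∷_) (select-all w)

Δterm-none : ∀ w → IsPacked w → Δterm w (replicate (length w) false) ≡ ([] , w)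
Δterm-none w w-packed = cong₂ _,_ (cong pack (select-none w)) (trans quotient-by-[] w-packed)
  where
  quotient-by-[] : pack (select (map not (replicate (length w) false)) w
                          /w select (replicate (length w) false) w) ≡ pack w
  quotient-by-[] =
    trans (cong₂ (λ m u → pack (select m w /w u)) (LP.map-replicate not (length w) false) (select-none w))
          (cong pack (trans (LP.map-id (select (replicate (length w) true) w)) (select-all w)))

Δterm-all : ∀ w → IsPacked w → Δterm w (replicate (length w) true) ≡ (w , [])
Δterm-all w w-packed = cong₂ _,_ (trans (cong pack (select-all w)) w-packed)
  (trans (cong (λ m → pack (select m w /w select (replicate (length w) true) w))
               (LP.map-replicate not (length w) true))
         (cong (λ u → pack (u /w select (replicate (length w) true) w)) (select-none w)))

module Coalgebra {c ℓ} (K : Field c ℓ) where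
  open Linear K
  open Field K using (Carrier; _≈_; _+_; _*_; 0#; 1#)

  Δ⊗Id-term : ∀ k w → Δ⊗Id (map (k ,_) (Δterms w)) ≡ map (λ p → k , leftTerm w p) (leftIndices w)
  Δ⊗Id-term k w =
    begin
      Δ⊗Id (map (k ,_) (map (Δterm w) M))
    ≡⟨ LP.concatMap-map _ (k ,_) (map (Δterm w) M) ⟩
      concatMap _ (map (Δterm w) M)
    ≡⟨ LP.concatMap-map _ (Δterm w) M ⟩
      concatMap _ M
    ≡⟨ LP.concatMap-cong term M ⟩
      concatMap (map (λ p → k , leftTerm w p) ∘ (λ I → map (I ,_) (masks (length (select I w))))) M
    ≡⟨ LP.map-concatMap _ _ M ⟨
      map (λ p → k , leftTerm w p) (leftIndices w)
    ∎
    where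
    open ≡-Reasoning
    M = masks (length w)
    term : ∀ I → map (λ { (a , b) → k , (a , b , proj₂ (Δterm w I)) })
                      (map (Δterm (pack (select I w))) (masks (length (pack (select I w)))))
               ≡ map (λ p → k , leftTerm w p) (map (I ,_) (masks (length (select I w))))
    term I = trans (map-map-cong (λ _ → refl) (masks (length (pack (select I w)))))
                   (cong (λ n → map (λ p → k , leftTerm w p) (map (I ,_) (masks n)))
                         (LP.length-map (rank (select I w)) (select I w)))

  Id⊗Δ-term : ∀ k w → Id⊗Δ (map (k ,_) (Δterms w)) ≡ map (λ p → k , rightTerm w p) (rightIndices w)
  Id⊗Δ-term k w =
    begin
      Id⊗Δ (map (k ,_) (map (Δterm w) M))
    ≡⟨ LP.concatMap-map _ (k ,_) (map (Δterm w) M) ⟩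
      concatMap _ (map (Δterm w) M)
    ≡⟨ LP.concatMap-map _ (Δterm w) M ⟩
      concatMap _ M
    ≡⟨ LP.concatMap-cong term M ⟩
      concatMap (map (λ p → k , rightTerm w p)
                   ∘ (λ I → map (I ,_) (masks (length (select (map not I) w))))) M
    ≡⟨ LP.map-concatMap _ _ M ⟨
      map (λ p → k , rightTerm w p) (rightIndices w)
    ∎
    where
    open ≡-Reasoning
    M = masks (length w)
    term : ∀ I → let v = proj₂ (Δterm w I) in
           map (λ { (b , b′) → k , (proj₁ (Δterm w I) , b , b′) }) (map (Δterm v) (masks (length v)))
             ≡ map (λ p → k , rightTerm w p) (map (I ,_) (masks (length (select (map not I) w))))
    term I = trans (map-map-cong (λ _ → refl) (masks (length v)))
                   (cong (λ n → map (λ p → k , rightTerm w p) (map (I ,_) (masks n)))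
                         (trans (LP.length-map (rank quotient) quotient)
                                (LP.length-map (quotientLetter (select I w)) (select (map not I) w))))
      where
      quotient = select (map not I) w /w select I w
      v = pack quotient

  coassociative-term : ∀ k w → Δ⊗Id (map (k ,_) (Δterms w)) ↭ Id⊗Δ (map (k ,_) (Δterms w))
  coassociative-term k w =
    begin
      Δ⊗Id (map (k ,_) (Δterms w))
    ≡⟨ Δ⊗Id-term k w ⟩
      map (λ p → k , leftTerm w p) (leftIndices w)
    ↭⟨ Perm.map⁺ _ (leftIndices-↭ w) ⟩
      map (λ p → k , leftTerm w p) (map leftIndex cs)
    ≡⟨ map-map-cong (λ t → cong (k ,_) (leftTerm≡rightTerm w t)) cs ⟩
      map (λ p → k , rightTerm w p) (map rightIndex cs)
    ↭⟨ Perm.map⁺ _ (rightIndices-↭ w) ⟨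
      map (λ p → k , rightTerm w p) (rightIndices w)
    ≡⟨ Id⊗Δ-term k w ⟨
      Id⊗Δ (map (k ,_) (Δterms w))
    ∎
    where
    open PermutationReasoning
    cs = colourings (length w)

  coassociative-↭ : ∀ x → Δ⊗Id (Δ x) ↭ Id⊗Δ (Δ x)
  coassociative-↭ []            = ↭-reflexive refl
  coassociative-↭ ((k , w) ∷ x) =
    begin
      Δ⊗Id (map (k ,_) (Δterms w) ++ Δ x)
    ≡⟨ LP.concatMap-++ _ (map (k ,_) (Δterms w)) (Δ x) ⟩
      Δ⊗Id (map (k ,_) (Δterms w)) ++ Δ⊗Id (Δ x)
    ↭⟨ Perm.++⁺ (coassociative-term k w) (coassociative-↭ x) ⟩
      Id⊗Δ (map (k ,_) (Δterms w)) ++ Id⊗Δ (Δ x)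
    ≡⟨ LP.concatMap-++ _ (map (k ,_) (Δterms w)) (Δ x) ⟨
      Id⊗Δ (map (k ,_) (Δterms w) ++ Δ x)
    ∎
    where open PermutationReasoning

  module F = Field K

  coeff-↭ : ∀ {A : Set} (_≟_ : DecidableEquality A) {xs ys : LC A} → xs ↭ ys →
    xs ≋[ _≟_ ] ys
  coeff-↭ _≟_ (↭.refl)        a = F.refl
  coeff-↭ _≟_ (↭.prep _ p)    a = F.+-cong F.refl (coeff-↭ _≟_ p a)
  coeff-↭ _≟_ (↭.swap (k₁ , b₁) (k₂ , b₂) p) a =
    F.trans (F.sym (F.+-assoc u₁ u₂ _))
      (F.trans (F.+-cong (F.+-comm u₁ u₂) (coeff-↭ _≟_ p a)) (F.+-assoc u₂ u₁ _))
    where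
    u₁ = if does (b₁ ≟ a) then k₁ else 0#
    u₂ = if does (b₂ ≟ a) then k₂ else 0#
  coeff-↭ _≟_ (↭.trans p q)   a = F.trans (coeff-↭ _≟_ p a) (coeff-↭ _≟_ q a)

  coeff-++ : ∀ {A : Set} (_≟_ : DecidableEquality A) (xs ys : LC A) a →
    coeff _≟_ (xs ++ ys) a ≈ coeff _≟_ xs a + coeff _≟_ ys a
  coeff-++ _≟_ []       ys a = F.sym (F.+-identityˡ _)
  coeff-++ _≟_ (_ ∷ xs) ys a =
    F.trans (F.+-cong F.refl (coeff-++ _≟_ xs ys a)) (F.sym (F.+-assoc _ _ _))

  coeff-zeros : ∀ {A : Set} (_≟_ : DecidableEquality A) (xs : LC A) a →
    All (λ p → proj₁ p ≈ 0#) xs → coeff _≟_ xs a ≈ 0#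
  coeff-zeros _≟_ []             a []          = F.refl
  coeff-zeros _≟_ ((k , b) ∷ xs) a (k≈0 ∷ zs) =
    F.trans (F.+-cong term≈0 (coeff-zeros _≟_ xs a zs)) (F.+-identityˡ 0#)
    where
    term≈0 : (if does (b ≟ a) then k else 0#) ≈ 0#
    term≈0 with does (b ≟ a)
    ... | true  = k≈0
    ... | false = F.refl

  coeff-single : ∀ {A : Set} (_≟_ : DecidableEquality A) {k k′ : Carrier} {b : A} → k ≈ k′ →
    ((k , b) ∷ []) ≋[ _≟_ ] ((k′ , b) ∷ [])
  coeff-single _≟_ {b = b} k≈k′ a with does (b ≟ a)
  ... | true  = F.+-cong k≈k′ F.refl
  ... | false = F.refl

  left-inverse-of-Δ : (f : Carrier × (Word × Word) → Carrier × Word) →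
    (∀ k w → IsPacked w → map f (map (k ,_) (Δterms w)) ≋[ _≟W_ ] ((k , w) ∷ [])) →
    ∀ x → InH x → map f (Δ x) ≋[ _≟W_ ] x
  left-inverse-of-Δ f f-term []            []          a = F.refl
  left-inverse-of-Δ f f-term ((k , w) ∷ x) (pw ∷ px) a =
    begin
      coeff _≟W_ (map f (map (k ,_) (Δterms w) ++ Δ x)) a
    ≡⟨ cong (λ L → coeff _≟W_ L a) (LP.map-++ f (map (k ,_) (Δterms w)) (Δ x)) ⟩
      coeff _≟W_ (map f (map (k ,_) (Δterms w)) ++ map f (Δ x)) a
    ≈⟨ coeff-++ _≟W_ (map f (map (k ,_) (Δterms w))) (map f (Δ x)) a ⟩
      coeff _≟W_ (map f (map (k ,_) (Δterms w))) a + coeff _≟W_ (map f (Δ x)) a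
    ≈⟨ F.+-cong (f-term k w pw a) (left-inverse-of-Δ f f-term x px a) ⟩
      coeff _≟W_ ((k , w) ∷ []) a + coeff _≟W_ x a
    ≈⟨ F.+-cong (F.+-identityʳ _) F.refl ⟩
      coeff _≟W_ ((k , w) ∷ x) a
    ∎
    where open SetoidReasoning F.setoid

  ε-pack-nonempty : ∀ u → 0 < length u → ε (pack u) ≡ 0#
  ε-pack-nonempty (_ ∷ _) _ = refl

  -- (ε ⊗ Id)(k·Δ(w)) = k·w : only I = ∅ contributes.
  counit-left-term : ∀ k w → IsPacked w → ε⊗Id (map (k ,_) (Δterms w)) ≋[ _≟W_ ] ((k , w) ∷ [])
  counit-left-term k w w-packed a =
    begin
      coeff _≟W_ (ε⊗Id (map (k ,_) (map (Δterm w) (masks (length w))))) a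
    ≡⟨ cong (λ L → coeff _≟W_ L a) as-map ⟩
      coeff _≟W_ (map E (nonemptyMasks w) ++ E none ∷ []) a
    ≈⟨ coeff-++ _≟W_ (map E (nonemptyMasks w)) _ a ⟩
      coeff _≟W_ (map E (nonemptyMasks w)) a + coeff _≟W_ (E none ∷ []) a
    ≈⟨ F.+-cong (coeff-zeros _≟W_ _ a (AllP.map⁺ (All.map (λ {I} → vanishes {I}) (nonemptyMasks-select w)))) F.refl ⟩
      0# + coeff _≟W_ (E none ∷ []) a
    ≈⟨ F.+-identityˡ _ ⟩
      coeff _≟W_ (E none ∷ []) a
    ≡⟨ cong (λ p → coeff _≟W_ ((k * ε (proj₁ p) , proj₂ p) ∷ []) a) (Δterm-none w w-packed) ⟩
      coeff _≟W_ ((k * 1# , w) ∷ []) a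
    ≈⟨ coeff-single _≟W_ {b = w} (F.*-identityʳ k) a ⟩
      coeff _≟W_ ((k , w) ∷ []) a
    ∎
    where
    open SetoidReasoning F.setoid
    none = replicate (length w) false
    E : List Bool → Carrier × Word
    E I = k * ε (proj₁ (Δterm w I)) , proj₂ (Δterm w I)
    as-map : ε⊗Id (map (k ,_) (map (Δterm w) (masks (length w)))) ≡ map E (nonemptyMasks w) ++ E none ∷ []
    as-map = trans (sym (LP.map-∘ _)) (trans (sym (LP.map-∘ _))
               (trans (cong (map E) (masks-nonempty w)) (LP.map-++ E (nonemptyMasks w) (none ∷ []))))
    vanishes : ∀ {I} → 0 < length (select I w) → proj₁ (E I) ≈ 0#
    vanishes {I} nonempty =
      F.trans (F.*-cong F.refl (F.reflexive (ε-pack-nonempty (select I w) nonempty))) (F.zeroʳ k)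

  -- (Id ⊗ ε)(k·Δ(w)) = k·w : only I = [1..|w|] contributes.
  counit-right-term : ∀ k w → IsPacked w → Id⊗ε (map (k ,_) (Δterms w)) ≋[ _≟W_ ] ((k , w) ∷ [])
  counit-right-term k w w-packed a =
    begin
      coeff _≟W_ (Id⊗ε (map (k ,_) (map (Δterm w) (masks (length w))))) a
    ≡⟨ cong (λ L → coeff _≟W_ L a) as-map ⟩
      coeff _≟W_ (E all ∷ map E (properMasks w)) a
    ≈⟨ F.+-cong F.refl (coeff-zeros _≟W_ _ a (AllP.map⁺ (All.map (λ {I} → vanishes {I}) (properMasks-select w)))) ⟩
      coeff _≟W_ (E all ∷ []) a
    ≡⟨ cong (λ p → coeff _≟W_ ((k * ε (proj₂ p) , proj₁ p) ∷ []) a) (Δterm-all w w-packed) ⟩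
      coeff _≟W_ ((k * 1# , w) ∷ []) a
    ≈⟨ coeff-single _≟W_ {b = w} (F.*-identityʳ k) a ⟩
      coeff _≟W_ ((k , w) ∷ []) a
    ∎
    where
    open SetoidReasoning F.setoid
    all = replicate (length w) true
    E : List Bool → Carrier × Word
    E I = k * ε (proj₂ (Δterm w I)) , proj₁ (Δterm w I)
    as-map : Id⊗ε (map (k ,_) (map (Δterm w) (masks (length w)))) ≡ E all ∷ map E (properMasks w)
    as-map = trans (sym (LP.map-∘ _)) (trans (sym (LP.map-∘ _)) (cong (map E) (masks-proper w)))
    vanishes : ∀ {I} → 0 < length (select (map not I) w) → proj₁ (E I) ≈ 0#
    vanishes {I} nonempty = F.trans
      (F.*-cong F.refl (F.reflexive (ε-pack-nonempty (select (map not I) w /w select I w)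
        (subst (0 <_) (sym (LP.length-map (quotientLetter (select I w)) (select (map not I) w))) nonempty))))
      (F.zeroʳ k)

mainTheorem10 : ∀ {c ℓ} (K : Field c ℓ) (x : Linear.LC K Word) → Linear.InH K x →
    (Linear._≋[_]_ K (Linear.Δ⊗Id K (Linear.Δ K x)) _≟W3_ (Linear.Id⊗Δ K (Linear.Δ K x)))
    × (Linear._≋[_]_ K (Linear.ε⊗Id K (Linear.Δ K x)) _≟W_ x)
    × (Linear._≋[_]_ K (Linear.Id⊗ε K (Linear.Δ K x)) _≟W_ x)
mainTheorem10 K x x∈H =
    coeff-↭ _≟W3_ (coassociative-↭ x)
  , left-inverse-of-Δ _ counit-left-term x x∈H
  , left-inverse-of-Δ _ counit-right-term x x∈H
  where open Coalgebra K
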